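{- Consider an ECO-system with axiom $(s_0)$ whose rules can be written in the form $$(k)\leadsto (c_1(k))\,(c_2(k))\cdots(c_{k-m}(k))\,(k+a_1)\,(k+a_2)\cdots(k+a_m),$$ where $m\ge0$ and $1\le a_1\le a_2\le\cdots\le a_m$ are fixed integers and the functions $c_i$ are uniformly bounded. Let $C=\max_{i,k}\{s_0,c_i(k)\}$, write $e_1(k),\dots,e_k(k)$ for the full list of productions of $(k)$ above, and let $\pi_{j,k}=|\{i\le j:\ e_i(j)=k\}|$ be the number of one-step transitions from label $j$ to label $k$. If for every $k\le C$ the power series $\sum_{j\ge1}\pi_{j,k}\,t^j$ is rational in $t$, then the generating function $F(z)=\sum_{n\ge0}f_nz^n$ of the system is rational.
   Context: An ECO-system $[(s_0),\ \{(k)\leadsto (e_1(k))\cdots(e_k(k))\}]$ consists of a positive integer axiom $s_0$ and, for each positive integer label $k$, a list of $k$ positive integers $e_1(k),\dots,e_k(k)$. Its generating tree is the rooted plane tree whose root is labeled $s_0$ and in which every node labeled $k$ has exactly $k$ children, labeled $e_1(k),\dots,e_k(k)$. The root is at level $0$; $f_n$ denotes the number of nodes at level $n$ (so $f_0=1$), and $F(z)=\sum_{n\ge0} f_n z^n$. -}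

module Defs where

open import Data.Nat using (ℕ; zero; suc; _+_; _∸_; _≤_; _≟_)
open import Data.Integer as ℤ using (ℤ)
open import Data.List using (List; []; _∷_; concatMap; length; take; drop; map)
open import Data.List.Relation.Unary.All using (All)
open import Data.List.Relation.Unary.Linked using (Linked)
open import Data.List.Membership.Propositional using (_∈_)
open import Data.Vec using (Vec; toList; count)
import Data.Vec.Relation.Unary.All as VAll
open import Data.Product using (Σ; ∃; _×_)
open import Data.Sum using (_⊎_)
open import Relation.Binary.PropositionalEquality using (_≡_; _≢_)

record ECO : Set where
  field
    axiom     : ℕ
    rule      : (k : ℕ) → Vec ℕ k
    axiom-pos : 1 ≤ axiom
    rule-pos  : ∀ k → VAll.All (1 ≤_) (rule k)

module _ (E : ECO) where
  open ECO E

  prods : ℕ → List ℕ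
  prods k = toList (rule k)

  -- multiset (list) of labels of the nodes at level n of the generating tree
  level : ℕ → List ℕ
  level zero    = axiom ∷ []
  level (suc n) = concatMap prods (level n)

  f : ℕ → ℕ
  f n = length (level n)

  Occurs : ℕ → Set
  Occurs k = ∃ λ n → k ∈ level n

  π : ℕ → ℕ → ℕ
  π j k = count (_≟ k) (rule j)

  -- the "c-part" c_1(k) ... c_{k-m}(k) of the rule of k (m = number of shifted labels)
  cpart : ℕ → ℕ → List ℕ
  cpart m k = take (k ∸ m) (prods k)

  HasForm : List ℕ → Set
  HasForm as = ∀ k → Occurs k →
      (length as ≤ k) × (drop (k ∸ length as) (prods k) ≡ map (k +_) as)

  IsMaxC : List ℕ → ℕ → Set
  IsMaxC as C =
      (axiom ≤ C)
    × (∀ k → Occurs k → All (_≤ C) (cpart (length as) k))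
    × ((C ≡ axiom) ⊎ (∃ λ k → Occurs k × (C ∈ cpart (length as) k)))

coeff : List ℤ → ℕ → ℤ
coeff []       _       = ℤ.0ℤ
coeff (p ∷ ps) zero    = p
coeff (p ∷ ps) (suc n) = coeff ps n

-- coefficient n of Q(z) · S(z), Q polynomial, S formal power series
conv : List ℤ → (ℕ → ℤ) → ℕ → ℤ
conv []       s n       = ℤ.0ℤ
conv (q ∷ qs) s zero    = q ℤ.* s zero
conv (q ∷ qs) s (suc n) = q ℤ.* s (suc n) ℤ.+ conv qs s n

-- a formal power series with integer coefficients is rational:
-- S = P / Q for polynomials P, Q with Q(0) ≠ 0
IsRational : (ℕ → ℤ) → Set
IsRational s = Σ ℤ λ q₀ → Σ (List ℤ) λ qs → Σ (List ℤ) λ P →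
  (q₀ ≢ ℤ.0ℤ) × (∀ n → conv (q₀ ∷ qs) s n ≡ coeff P n)

ℕseries : (ℕ → ℕ) → ℕ → ℤ
ℕseries s n = ℤ.+ (s n)

πseries : ECO → ℕ → ℕ → ℕ
πseries E k zero    = 0
πseries E k (suc j) = π E (suc j) k

-- For g : ℕ → ℤ let Φₙ(g) = Σ g(x) over the labels x at level n, so that fₙ = Φₙ(1) and
-- Φₙ₊₁(g) = Φₙ(Tg) with (Tg)(j) = Σᵢ g(eᵢ(j)). On the labels of the tree the rule form gives
--   (Tg)(j) = Σ_{c ≤ C} g(c) π_{j,c} + Σₐ (g − g|_{[0,C]})(j + a),
-- so the ℤ-module spanned by 1, the indicators δ_y of finitely many labels and finitely many
-- shifts j ↦ π_{j+r,c} is mapped into itself by μT for a suitable μ ≠ 0: rationality of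
-- Σⱼ π_{j,c} tʲ expresses every further shift by the first ones, up to a power of the constant
-- term of its denominator. With d generators, the coefficient vectors of (μT)ᵏ1, k ≤ d, are
-- linearly dependent, and applying Φₙ to a dependency yields a recurrence Σₖ cₖ μᵏ fₙ₊ₖ = 0.
module Submission where

open import Defs
open import Data.Nat using (ℕ; _≤_)
open import Data.List using (List)
import Data.List
open import Data.List.Relation.Unary.All using (All)
open import Data.List.Relation.Unary.Linked using (Linked)
open import Data.Product using (∃; _×_)

open import Data.Nat as ℕ using (zero; suc; _<_; _∸_; z≤n; s≤s)
import Data.Nat.Properties as ℕ
open import Data.Integer as ℤ using (ℤ; +_; 0ℤ; 1ℤ; _+_; _*_; _-_; -_; _^_)
import Data.Integer.Properties as ℤ
open import Data.Integer.Tactic.RingSolver using (solve-∀)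
open import Data.Fin using (Fin; toℕ; fromℕ<)
import Data.Fin.Properties as Fin
open import Data.List as List
  using ([]; _∷_; _++_; map; concatMap; length; drop; replicate)
  using (applyUpTo; applyDownFrom; downFrom; allFin)
import Data.List.Properties as List
open import Data.List.Membership.Propositional using (_∈_; _∉_; lose; find)
open import Data.List.Membership.Propositional.Properties
  using (∈-map⁺; ∈-++⁺ˡ; ∈-++⁺ʳ; ∈-concatMap⁺; ∈-∃++)
  using (∈-downFrom⁺; ∈-downFrom⁻; ∈-allFin)
open import Data.List.Relation.Unary.Any using (Any; here; there)
import Data.List.Relation.Unary.Any as Any
import Data.List.Relation.Unary.Any.Properties as Any
import Data.List.Relation.Unary.All as All
import Data.List.Relation.Unary.All.Properties as All
open import Data.Vec as Vec using (Vec)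
open import Data.Product using (_,_; proj₁; proj₂)
open import Data.Sum using (inj₁; inj₂)
open import Data.Empty using (⊥-elim)
open import Data.Bool using (true; false; T)
open import Data.Unit using (tt)
open import Function using (_∘_)
open import Relation.Nullary using (yes; no)
open import Relation.Binary.PropositionalEquality
open ≡-Reasoning

private
  variable
    A B : Set

*-≢0 : ∀ {a b} → a ≢ 0ℤ → b ≢ 0ℤ → a * b ≢ 0ℤ
*-≢0 {a} a≢0 b≢0 ab≡0 with ℤ.i*j≡0⇒i≡0∨j≡0 a ab≡0
... | inj₁ a≡0 = a≢0 a≡0
... | inj₂ b≡0 = b≢0 b≡0

^-≢0 : ∀ {a} n → a ≢ 0ℤ → a ^ n ≢ 0ℤ
^-≢0 zero    a≢0 = λ ()
^-≢0 (suc n) a≢0 = *-≢0 a≢0 (^-≢0 n a≢0)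

Seq : Set
Seq = ℕ → ℤ

∑ : List A → (A → ℤ) → ℤ
∑ []       g = 0ℤ
∑ (x ∷ xs) g = g x + ∑ xs g

infix 5 ∑
syntax ∑ xs (λ x → e) = ∑[ x ∈ xs ] e

∑-cong : (xs : List A) {g h : A → ℤ} → (∀ x → x ∈ xs → g x ≡ h x) → ∑ xs g ≡ ∑ xs h
∑-cong []       g≡h = refl
∑-cong (x ∷ xs) g≡h =
  cong₂ _+_ (g≡h x (here refl)) (∑-cong xs (λ y y∈xs → g≡h y (there y∈xs)))

∑-ext : (xs : List A) {g h : A → ℤ} → (∀ x → g x ≡ h x) → ∑ xs g ≡ ∑ xs h
∑-ext xs g≡h = ∑-cong xs (λ x _ → g≡h x)

∑-zero : (xs : List A) → ∑[ x ∈ xs ] 0ℤ ≡ 0ℤ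
∑-zero []       = refl
∑-zero (x ∷ xs) = trans (ℤ.+-identityˡ _) (∑-zero xs)

∑-+ : (g h : A → ℤ) (xs : List A) → ∑[ x ∈ xs ] (g x + h x) ≡ ∑ xs g + ∑ xs h
∑-+ g h []       = refl
∑-+ g h (x ∷ xs) =
  trans (cong (_+_ (g x + h x)) (∑-+ g h xs)) (interchange (g x) (h x) (∑ xs g) (∑ xs h))
  where
  interchange : ∀ a b c d → a + b + (c + d) ≡ a + c + (b + d)
  interchange = solve-∀

∑-scale : (a : ℤ) (g : A → ℤ) (xs : List A) → ∑[ x ∈ xs ] (a * g x) ≡ a * ∑ xs g
∑-scale a g []       = sym (ℤ.*-zeroʳ a)
∑-scale a g (x ∷ xs) =
  trans (cong (_+_ (a * g x)) (∑-scale a g xs)) (sym (ℤ.*-distribˡ-+ a (g x) (∑ xs g)))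

∑-linear : (a : ℤ) (g h : A → ℤ) (xs : List A) →
  ∑[ x ∈ xs ] (a * g x + h x) ≡ a * ∑ xs g + ∑ xs h
∑-linear a g h xs = trans (∑-+ (λ x → a * g x) h xs) (cong (_+ ∑ xs h) (∑-scale a g xs))

∑-sub : (g h : A → ℤ) (xs : List A) → ∑[ x ∈ xs ] (g x - h x) ≡ ∑ xs g - ∑ xs h
∑-sub g h []       = refl
∑-sub g h (x ∷ xs) =
  trans (cong (_+_ (g x - h x)) (∑-sub g h xs)) (interchange (g x) (h x) (∑ xs g) (∑ xs h))
  where
  interchange : ∀ a b c d → a - b + (c - d) ≡ a + c - (b + d)
  interchange = solve-∀

∑-++ : (g : A → ℤ) (xs ys : List A) → ∑ (xs ++ ys) g ≡ ∑ xs g + ∑ ys g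
∑-++ g []       ys = sym (ℤ.+-identityˡ _)
∑-++ g (x ∷ xs) ys = trans (cong (_+_ (g x)) (∑-++ g xs ys)) (sym (ℤ.+-assoc (g x) _ _))

∑-map : (g : B → ℤ) (f : A → B) (xs : List A) → ∑ (map f xs) g ≡ ∑[ x ∈ xs ] g (f x)
∑-map g f []       = refl
∑-map g f (x ∷ xs) = cong (_+_ (g (f x))) (∑-map g f xs)

∑-concatMap : (g : B → ℤ) (p : A → List B) (xs : List A) →
  ∑ (concatMap p xs) g ≡ ∑[ x ∈ xs ] ∑ (p x) g
∑-concatMap g p []       = refl
∑-concatMap g p (x ∷ xs) =
  trans (∑-++ g (p x) (concatMap p xs)) (cong (_+_ (∑ (p x) g)) (∑-concatMap g p xs))

∑-one : (xs : List A) → ∑[ x ∈ xs ] 1ℤ ≡ + length xs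
∑-one []       = refl
∑-one (x ∷ xs) = cong (_+_ 1ℤ) (∑-one xs)

∑-comm : (F : A → B → ℤ) (xs : List A) (ys : List B) →
  ∑[ x ∈ xs ] ∑[ y ∈ ys ] F x y ≡ ∑[ y ∈ ys ] ∑[ x ∈ xs ] F x y
∑-comm F []       ys = sym (∑-zero ys)
∑-comm F (x ∷ xs) ys =
  trans (cong (_+_ (∑ ys (F x))) (∑-comm F xs ys))
        (sym (∑-+ (F x) (λ y → ∑[ x′ ∈ xs ] F x′ y) ys))

δ : ℕ → Seq
δ zero    zero    = 1ℤ
δ zero    (suc _) = 0ℤ
δ (suc _) zero    = 0ℤ
δ (suc y) (suc j) = δ y j

δ-diag : ∀ y → δ y y ≡ 1ℤ
δ-diag zero    = refl
δ-diag (suc y) = δ-diag y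

δ-off : ∀ {y j} → y ≢ j → δ y j ≡ 0ℤ
δ-off {zero}  {zero}  y≢j = ⊥-elim (y≢j refl)
δ-off {zero}  {suc j} _   = refl
δ-off {suc y} {zero}  _   = refl
δ-off {suc y} {suc j} y≢j = δ-off (y≢j ∘ cong suc)

∑-δ-∉ : (g : Seq) {y : ℕ} (zs : List ℕ) → y ∉ zs → ∑[ z ∈ zs ] g z * δ z y ≡ 0ℤ
∑-δ-∉ g {y} zs y∉zs = trans (∑-cong zs vanish) (∑-zero zs)
  where
  vanish : ∀ z → z ∈ zs → g z * δ z y ≡ 0ℤ
  vanish z z∈zs =
    trans (cong (g z *_) (δ-off {z} {y} (λ { refl → y∉zs z∈zs }))) (ℤ.*-zeroʳ (g z))

∑-δ-downFrom : (g : Seq) {y n : ℕ} → y < n → ∑[ z ∈ downFrom n ] g z * δ z y ≡ g y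
∑-δ-downFrom g {y} {suc n} y<1+n with ℕ.m≤n⇒m<n∨m≡n (ℕ.≤-pred y<1+n)
... | inj₁ y<n  = trans (cong₂ _+_ (trans (cong (g n *_) (δ-off (ℕ.>⇒≢ y<n))) (ℤ.*-zeroʳ (g n)))
                                   (∑-δ-downFrom g y<n))
                        (ℤ.+-identityˡ (g y))
... | inj₂ refl = trans (cong₂ _+_ (trans (cong (g y *_) (δ-diag y)) (ℤ.*-identityʳ (g y)))
                                   (∑-δ-∉ g (downFrom y) (ℕ.<-irrefl refl ∘ ∈-downFrom⁻)))
                        (ℤ.+-identityʳ (g y))

coeff-beyond : ∀ Q {n} → length Q ≤ n → coeff Q n ≡ 0ℤ
coeff-beyond []      _           = refl
coeff-beyond (q ∷ Q) (s≤s |Q|≤n) = coeff-beyond Q |Q|≤n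

coeff-drop : ∀ Q k j → coeff Q (j ℕ.+ k) ≡ coeff (drop k Q) j
coeff-drop Q       zero    j = cong (coeff Q) (ℕ.+-identityʳ j)
coeff-drop []      (suc k) j = refl
coeff-drop (q ∷ Q) (suc k) j = trans (cong (coeff (q ∷ Q)) (ℕ.+-suc j k)) (coeff-drop Q k j)

coeff-δ-expansion : ∀ Q j → coeff Q j ≡ ∑[ i ∈ downFrom (length Q) ] coeff Q i * δ i j
coeff-δ-expansion Q j with j ℕ.<? length Q
... | yes j<|Q| = sym (∑-δ-downFrom (coeff Q) j<|Q|)
... | no  j≮|Q| =
  trans (coeff-beyond Q (ℕ.≮⇒≥ j≮|Q|))
        (sym (∑-δ-∉ (coeff Q) (downFrom (length Q)) (j≮|Q| ∘ ∈-downFrom⁻)))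

conv-singleton : ∀ c (s : Seq) n → conv (c ∷ []) s n ≡ c * s n
conv-singleton c s zero    = refl
conv-singleton c s (suc n) = ℤ.+-identityʳ (c * s (suc n))

record RationalForm (s : Seq) : Set where
  field
    q₀       : ℤ
    qs       : List ℤ
    numer    : List ℤ
    q₀≢0     : q₀ ≢ 0ℤ
    identity : ∀ n → conv (q₀ ∷ qs) s n ≡ coeff numer n

toRationalForm : ∀ {s} → IsRational s → RationalForm s
toRationalForm (q₀ , qs , P , q₀≢0 , identity) = record
  { q₀ = q₀ ; qs = qs ; numer = P ; q₀≢0 = q₀≢0 ; identity = identity }

comb : Seq → List Seq → Seq
comb α []       x = 0ℤ
comb α (g ∷ gs) x = α 0 * g x + comb (α ∘ suc) gs x

comb-linear : (a : ℤ) (α β : Seq) (gs : List Seq) (x : ℕ) →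
  comb (λ k → a * α k + β k) gs x ≡ a * comb α gs x + comb β gs x
comb-linear a α β []       x = sym (trans (ℤ.+-identityʳ _) (ℤ.*-zeroʳ a))
comb-linear a α β (g ∷ gs) x =
  trans (cong (_+_ ((a * α 0 + β 0) * g x)) (comb-linear a (α ∘ suc) (β ∘ suc) gs x))
        (regroup a (α 0) (β 0) (g x) (comb (α ∘ suc) gs x) (comb (β ∘ suc) gs x))
  where
  regroup : ∀ a u v w s t → (a * u + v) * w + (a * s + t) ≡ a * (u * w + s) + (v * w + t)
  regroup = solve-∀

comb-vanishing : (α : Seq) (gs : List Seq) →
  (∀ k → k < length gs → α k ≡ 0ℤ) → ∀ x → comb α gs x ≡ 0ℤ
comb-vanishing α []       _   x = refl
comb-vanishing α (g ∷ gs) α≡0 x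
  rewrite α≡0 0 (s≤s z≤n)
        | comb-vanishing (α ∘ suc) gs (λ k k< → α≡0 (suc k) (s≤s k<)) x = refl

comb-unit : (gs : List Seq) {g : Seq} → g ∈ gs → ∃ λ i → ∀ x → g x ≡ comb (δ i) gs x
comb-unit (g ∷ gs) (here refl) =
  0 , λ x → sym (trans (cong (_+_ (1ℤ * g x)) (comb-vanishing (λ _ → 0ℤ) gs (λ _ _ → refl) x))
                       (trans (ℤ.+-identityʳ _) (ℤ.*-identityˡ (g x))))
comb-unit (h ∷ gs) (there g∈gs) with comb-unit gs g∈gs
... | i , g≡ = suc i , λ x → trans (g≡ x) (sym (ℤ.+-identityˡ _))

module Span (gs : List Seq) (P : ℕ → Set) where

  InSpan : Seq → Set
  InSpan g = ∃ λ α → ∀ x → P x → g x ≡ comb α gs x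

  InSpan-resp-on : {g h : Seq} → (∀ x → P x → g x ≡ h x) → InSpan g → InSpan h
  InSpan-resp-on g≡h (α , g≡α) = α , λ x x∈P → trans (sym (g≡h x x∈P)) (g≡α x x∈P)

  InSpan-resp : {g h : Seq} → (∀ x → g x ≡ h x) → InSpan g → InSpan h
  InSpan-resp g≡h = InSpan-resp-on (λ x _ → g≡h x)

  InSpan-gen : {g : Seq} → g ∈ gs → InSpan g
  InSpan-gen g∈gs with comb-unit gs g∈gs
  ... | i , g≡ = δ i , λ x _ → g≡ x

  InSpan-zero : InSpan (λ _ → 0ℤ)
  InSpan-zero = (λ _ → 0ℤ) , λ x _ → sym (comb-vanishing _ gs (λ _ _ → refl) x)

  InSpan-linear : (a : ℤ) {g h : Seq} → InSpan g → InSpan h → InSpan (λ x → a * g x + h x)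
  InSpan-linear a (α , g≡) (β , h≡) =
    (λ k → a * α k + β k) ,
    λ x x∈P → trans (cong₂ (λ u v → a * u + v) (g≡ x x∈P) (h≡ x x∈P))
                    (sym (comb-linear a α β gs x))

  InSpan-+ : {g h : Seq} → InSpan g → InSpan h → InSpan (λ x → g x + h x)
  InSpan-+ {g} {h} g∈ h∈ =
    InSpan-resp (λ x → cong (_+ h x) (ℤ.*-identityˡ (g x))) (InSpan-linear 1ℤ g∈ h∈)

  InSpan-scale : (a : ℤ) {g : Seq} → InSpan g → InSpan (λ x → a * g x)
  InSpan-scale a {g} g∈ =
    InSpan-resp (λ x → ℤ.+-identityʳ (a * g x)) (InSpan-linear a g∈ InSpan-zero)

  InSpan-rescale : ∀ {μ : ℤ} {g : Seq} (ν : ℤ) →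
    InSpan (λ x → μ * g x) → InSpan (λ x → ν * μ * g x)
  InSpan-rescale {μ} {g} ν μg∈ =
    InSpan-resp (λ x → sym (ℤ.*-assoc ν μ (g x))) (InSpan-scale ν μg∈)

  InSpan-sub : {g h : Seq} → InSpan g → InSpan h → InSpan (λ x → g x - h x)
  InSpan-sub {g} {h} g∈ h∈ = InSpan-resp (λ x → negate (g x) (h x)) (InSpan-linear (- 1ℤ) h∈ g∈)
    where
    negate : ∀ u v → - 1ℤ * v + u ≡ u - v
    negate = solve-∀

  InSpan-∑ : (xs : List A) (F : A → Seq) →
    (∀ a → a ∈ xs → InSpan (F a)) → InSpan (λ x → ∑[ a ∈ xs ] F a x)
  InSpan-∑ []       F F∈ = InSpan-zero
  InSpan-∑ (a ∷ xs) F F∈ =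
    InSpan-+ (F∈ a (here refl)) (InSpan-∑ xs F (λ b b∈xs → F∈ b (there b∈xs)))

  InSpan-δ-shift : ∀ {N} → (∀ y → y < N → InSpan (δ y)) →
    ∀ a {y} → y < N → InSpan (λ j → δ y (j ℕ.+ a))
  InSpan-δ-shift δ∈ zero    {y}     y<N =
    InSpan-resp (λ j → cong (δ y) (sym (ℕ.+-identityʳ j))) (δ∈ y y<N)
  InSpan-δ-shift δ∈ (suc a) {zero}  _   =
    InSpan-resp (λ j → cong (δ 0) (sym (ℕ.+-suc j a))) InSpan-zero
  InSpan-δ-shift δ∈ (suc a) {suc y} y<N =
    InSpan-resp (λ j → cong (δ (suc y)) (sym (ℕ.+-suc j a)))
                (InSpan-δ-shift δ∈ a (ℕ.<-trans (ℕ.n<1+n y) y<N))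

  InSpan-coeff-shift : ∀ Q k → (∀ i → i < length Q → InSpan (δ i)) →
    InSpan (λ j → coeff Q (j ℕ.+ k))
  InSpan-coeff-shift Q k δ∈ =
    InSpan-resp (λ j → trans (sym (coeff-δ-expansion (drop k Q) j)) (sym (coeff-drop Q k j)))
      (InSpan-∑ (downFrom (length (drop k Q))) _
                (λ i i∈ → InSpan-scale (coeff (drop k Q) i) (δ∈ i (bound i∈))))
    where
    bound : ∀ {i} → i ∈ downFrom (length (drop k Q)) → i < length Q
    bound i∈ = ℕ.<-≤-trans (∈-downFrom⁻ i∈)
                 (ℕ.≤-trans (ℕ.≤-reflexive (List.length-drop k Q)) (ℕ.m∸n≤m (length Q) k))

  module _ {s : Seq} (ρ : RationalForm s)
           (s-shift : ∀ r → r ≤ length (RationalForm.qs ρ) → InSpan (λ j → s (j ℕ.+ r)))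
           (numerator : ∀ i → i < length (RationalForm.numer ρ) → InSpan (δ i)) where

    open RationalForm ρ

    ScaledShift : ℕ → Set
    ScaledShift v = InSpan (λ j → q₀ ^ v * s (j ℕ.+ v))

    conv-shift : ∀ cs u → length cs ≤ suc u → (∀ v → v ≤ u → ScaledShift v) →
      InSpan (λ j → q₀ ^ u * conv cs s (j ℕ.+ u))
    conv-shift []          u       _           _  =
      InSpan-resp (λ j → sym (ℤ.*-zeroʳ (q₀ ^ u))) InSpan-zero
    conv-shift (c ∷ [])    zero    _           sh = InSpan-resp eq (InSpan-scale c (sh 0 z≤n))
      where
      rearrange : ∀ c x → c * (1ℤ * x) ≡ 1ℤ * (c * x)
      rearrange = solve-∀
      eq : ∀ j → c * (1ℤ * s (j ℕ.+ 0)) ≡ 1ℤ * conv (c ∷ []) s (j ℕ.+ 0)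
      eq j = trans (rearrange c (s (j ℕ.+ 0))) (cong (1ℤ *_) (sym (conv-singleton c s (j ℕ.+ 0))))
    conv-shift (c ∷ _ ∷ _) zero    (s≤s ())    _
    conv-shift (c ∷ cs)    (suc u) (s≤s |cs|≤) sh =
      InSpan-resp eq (InSpan-linear c (sh (suc u) ℕ.≤-refl) (InSpan-scale q₀ earlier))
      where
      earlier : InSpan (λ j → q₀ ^ u * conv cs s (j ℕ.+ u))
      earlier = conv-shift cs u |cs|≤ (λ v v≤u → sh v (ℕ.m≤n⇒m≤1+n v≤u))
      regroup : ∀ c q Q x y → c * (q * Q * x) + q * (Q * y) ≡ q * Q * (c * x + y)
      regroup = solve-∀
      eq : ∀ j → c * (q₀ ^ suc u * s (j ℕ.+ suc u)) + q₀ * (q₀ ^ u * conv cs s (j ℕ.+ u)) ≡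
                 q₀ ^ suc u * conv (c ∷ cs) s (j ℕ.+ suc u)
      eq j = begin
          c * (q₀ ^ suc u * s (j ℕ.+ suc u)) + q₀ * (q₀ ^ u * conv cs s (j ℕ.+ u))
        ≡⟨ cong (λ m → c * (q₀ ^ suc u * s m) + q₀ * (q₀ ^ u * conv cs s (j ℕ.+ u)))
                (ℕ.+-suc j u) ⟩
          c * (q₀ * q₀ ^ u * s (suc (j ℕ.+ u))) + q₀ * (q₀ ^ u * conv cs s (j ℕ.+ u))
        ≡⟨ regroup c q₀ (q₀ ^ u) (s (suc (j ℕ.+ u))) (conv cs s (j ℕ.+ u)) ⟩
          q₀ ^ suc u * conv (c ∷ cs) s (suc (j ℕ.+ u))
        ≡⟨ cong (λ m → q₀ ^ suc u * conv (c ∷ cs) s m) (sym (ℕ.+-suc j u)) ⟩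
          q₀ ^ suc u * conv (c ∷ cs) s (j ℕ.+ suc u) ∎

    -- Coefficient j+t+1 of (q₀ + z·qs)·s = numer, multiplied by q₀ᵗ.
    scaledShift-step : ∀ t → length qs ≤ t →
      (∀ v → v ≤ t → ScaledShift v) → ScaledShift (suc t)
    scaledShift-step t |qs|≤t sh =
      InSpan-resp eq (InSpan-sub (InSpan-scale (q₀ ^ t) (InSpan-coeff-shift numer (suc t) numerator))
                               (conv-shift qs t (ℕ.m≤n⇒m≤1+n |qs|≤t) sh))
      where
      cancel : ∀ Q q x y → Q * (q * x + y) - Q * y ≡ q * Q * x
      cancel = solve-∀
      eq : ∀ j → q₀ ^ t * coeff numer (j ℕ.+ suc t) - q₀ ^ t * conv qs s (j ℕ.+ t) ≡
                 q₀ ^ suc t * s (j ℕ.+ suc t)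
      eq j = begin
          q₀ ^ t * coeff numer (j ℕ.+ suc t) - q₀ ^ t * conv qs s (j ℕ.+ t)
        ≡⟨ cong (λ m → q₀ ^ t * coeff numer m - q₀ ^ t * conv qs s (j ℕ.+ t)) (ℕ.+-suc j t) ⟩
          q₀ ^ t * coeff numer (suc (j ℕ.+ t)) - q₀ ^ t * conv qs s (j ℕ.+ t)
        ≡⟨ cong (λ z → q₀ ^ t * z - q₀ ^ t * conv qs s (j ℕ.+ t))
                (sym (identity (suc (j ℕ.+ t)))) ⟩
          q₀ ^ t * (q₀ * s (suc (j ℕ.+ t)) + conv qs s (j ℕ.+ t)) - q₀ ^ t * conv qs s (j ℕ.+ t)
        ≡⟨ cancel (q₀ ^ t) q₀ (s (suc (j ℕ.+ t))) (conv qs s (j ℕ.+ t)) ⟩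
          q₀ ^ suc t * s (suc (j ℕ.+ t))
        ≡⟨ cong (λ m → q₀ ^ suc t * s m) (sym (ℕ.+-suc j t)) ⟩
          q₀ ^ suc t * s (j ℕ.+ suc t) ∎

    scaledShifts-upTo : ∀ t v → v ≤ t → ScaledShift v
    scaledShifts-upTo zero    _ z≤n = InSpan-scale 1ℤ (s-shift 0 z≤n)
    scaledShifts-upTo (suc t) v v≤1+t with ℕ.m≤n⇒m<n∨m≡n v≤1+t
    ... | inj₁ v<1+t = scaledShifts-upTo t v (ℕ.≤-pred v<1+t)
    ... | inj₂ refl with suc t ℕ.≤? length qs
    ...   | yes 1+t≤|qs| = InSpan-scale (q₀ ^ suc t) (s-shift (suc t) 1+t≤|qs|)
    ...   | no  1+t≰|qs| = scaledShift-step t (ℕ.≤-pred (ℕ.≰⇒> 1+t≰|qs|)) (scaledShifts-upTo t)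

    InSpan-rationalShift : ∀ t → InSpan (λ j → q₀ ^ t * s (j ℕ.+ t))
    InSpan-rationalShift t = scaledShifts-upTo t t ℕ.≤-refl

  InSpan-image : (L : Seq → Seq) →
    (∀ a g h x → L (λ y → a * g y + h y) x ≡ a * L g x + L h x) →
    (∀ x → L (λ _ → 0ℤ) x ≡ 0ℤ) →
    ∀ {hs} → All (InSpan ∘ L) hs → ∀ α → InSpan (L (comb α hs))
  InSpan-image L L-linear L-zero All.[]         α = InSpan-resp (λ x → sym (L-zero x)) InSpan-zero
  InSpan-image L L-linear L-zero (h∈ All.∷ hs∈) α =
    InSpan-resp (λ x → sym (L-linear (α 0) _ _ x))
      (InSpan-linear (α 0) h∈ (InSpan-image L L-linear L-zero hs∈ (α ∘ suc)))

common-multiple : (Q : ℤ → A → Set) → (∀ {μ x} ν → Q μ x → Q (ν * μ) x) → {xs : List A} →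
  All (λ x → ∃ λ μ → μ ≢ 0ℤ × Q μ x) xs → ∃ λ μ → μ ≢ 0ℤ × All (Q μ) xs
common-multiple Q scale All.[] = 1ℤ , (λ ()) , All.[]
common-multiple Q scale ((μ , μ≢0 , q) All.∷ qs) with common-multiple Q scale qs
... | ν , ν≢0 , qs′ =
  ν * μ , *-≢0 ν≢0 μ≢0 ,
  scale ν q All.∷ All.map (λ {x} q′ → subst (λ κ → Q κ x) (ℤ.*-comm μ ν) (scale μ q′)) qs′

listComb : List ℤ → List Seq → Seq
listComb (c ∷ cs) (v ∷ vs) k = c * v k + listComb cs vs k
listComb _        _        k = 0ℤ

Nontrivial : List ℤ → Set
Nontrivial = Any (_≢ 0ℤ)

Dependent : ℕ → List Seq → Set
Dependent d vs =
  ∃ λ cs → length cs ≡ length vs × Nontrivial cs × (∀ k → k < d → listComb cs vs k ≡ 0ℤ)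

tailSeq : Seq → Seq
tailSeq v j = v (suc j)

-- Fraction-free elimination of coordinate 0 against the pivot p; the result is shifted down by one.
eliminate : Seq → Seq → Seq
eliminate p v j = p 0 * v (suc j) - v 0 * p (suc j)

listComb-tail : ∀ cs vs k → listComb cs (map tailSeq vs) k ≡ listComb cs vs (suc k)
listComb-tail []       vs       k = refl
listComb-tail (c ∷ cs) []       k = refl
listComb-tail (c ∷ cs) (v ∷ vs) k = cong (_+_ (c * v (suc k))) (listComb-tail cs vs k)

listComb-at0 : ∀ cs vs → All (λ v → v 0 ≡ 0ℤ) vs → listComb cs vs 0 ≡ 0ℤ
listComb-at0 []       vs       _               = refl
listComb-at0 (c ∷ cs) []       _               = refl
listComb-at0 (c ∷ cs) (v ∷ vs) (v0≡0 All.∷ vs0≡0) =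
  trans (cong₂ (λ u w → c * u + w) v0≡0 (listComb-at0 cs vs vs0≡0))
        (trans (ℤ.+-identityʳ (c * 0ℤ)) (ℤ.*-zeroʳ c))

listComb-eliminate : ∀ p cs vs k →
  listComb cs (map (eliminate p) vs) k ≡ p 0 * listComb cs vs (suc k) - listComb cs vs 0 * p (suc k)
listComb-eliminate p []       vs       k = sym (cong₂ _-_ (ℤ.*-zeroʳ (p 0)) (ℤ.*-zeroˡ (p (suc k))))
listComb-eliminate p (c ∷ cs) []       k = sym (cong₂ _-_ (ℤ.*-zeroʳ (p 0)) (ℤ.*-zeroˡ (p (suc k))))
listComb-eliminate p (c ∷ cs) (v ∷ vs) k =
  trans (cong (_+_ (c * eliminate p v k)) (listComb-eliminate p cs vs k))
        (regroup (p 0) c (v 0) (v (suc k)) (p (suc k)) (listComb cs vs 0) (listComb cs vs (suc k)))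
  where
  regroup : ∀ a c r₀ r₁ p₁ x₀ x₁ →
    c * (a * r₁ - r₀ * p₁) + (a * x₁ - x₀ * p₁) ≡ a * (c * r₁ + x₁) - (c * r₀ + x₀) * p₁
  regroup = solve-∀

listComb-scale : ∀ a cs vs k → listComb (map (a *_) cs) vs k ≡ a * listComb cs vs k
listComb-scale a []       vs       k = sym (ℤ.*-zeroʳ a)
listComb-scale a (c ∷ cs) []       k = sym (ℤ.*-zeroʳ a)
listComb-scale a (c ∷ cs) (v ∷ vs) k =
  trans (cong (_+_ (a * c * v k)) (listComb-scale a cs vs k)) (distrib a c (v k) (listComb cs vs k))
  where
  distrib : ∀ a c u w → a * c * u + a * w ≡ a * (c * u + w)
  distrib = solve-∀

listComb-insert : ∀ a b c₁ c₂ pre p post → length c₁ ≡ length pre → ∀ k →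
  listComb (map (a *_) c₁ ++ b ∷ map (a *_) c₂) (pre ++ p ∷ post) k ≡
  a * listComb (c₁ ++ c₂) (pre ++ post) k + b * p k
listComb-insert a b []        c₂ []        p post _ k =
  trans (cong (_+_ (b * p k)) (listComb-scale a c₂ post k)) (ℤ.+-comm (b * p k) (a * listComb c₂ post k))
listComb-insert a b (c ∷ c₁) c₂ (v ∷ pre) p post |c₁|≡ k =
  trans (cong (_+_ (a * c * v k)) (listComb-insert a b c₁ c₂ pre p post (ℕ.suc-injective |c₁|≡) k))
        (regroup a c (v k) (listComb (c₁ ++ c₂) (pre ++ post) k) (b * p k))
  where
  regroup : ∀ a c u L B → a * c * u + (a * L + B) ≡ a * (c * u + L) + B
  regroup = solve-∀

length-insert : ∀ (pre : List A) p post → length (pre ++ p ∷ post) ≡ suc (length (pre ++ post))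
length-insert []        p post = refl
length-insert (x ∷ pre) p post = cong suc (length-insert pre p post)

split : ∀ (c : List ℤ) n m → length c ≡ n ℕ.+ m →
  ∃ λ c₁ → ∃ λ c₂ → c ≡ c₁ ++ c₂ × length c₁ ≡ n × length c₂ ≡ m
split c       zero    m |c|≡ = [] , c , refl , refl , |c|≡
split (x ∷ c) (suc n) m |c|≡ with split c n m (ℕ.suc-injective |c|≡)
... | c₁ , c₂ , refl , |c₁| , |c₂| = x ∷ c₁ , c₂ , refl , cong suc |c₁| , |c₂|

dependent-base : ∀ v vs → Dependent 0 (v ∷ vs)
dependent-base v vs =
  1ℤ ∷ replicate (length vs) 0ℤ , cong suc (List.length-replicate (length vs)) , here (λ ()) , λ _ ()

dependent-shift : ∀ {d} vs → All (λ v → v 0 ≡ 0ℤ) vs →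
  Dependent d (map tailSeq vs) → Dependent (suc d) vs
dependent-shift vs vs0≡0 (cs , |cs| , cs≢0 , vanish) =
  cs , trans |cs| (List.length-map tailSeq vs) , cs≢0 , vanish′
  where
  vanish′ : ∀ k → k < suc _ → listComb cs vs k ≡ 0ℤ
  vanish′ zero    _         = listComb-at0 cs vs vs0≡0
  vanish′ (suc k) (s≤s k<d) = trans (sym (listComb-tail cs vs k)) (vanish k k<d)

dependent-pivot : ∀ {d} pre p post → p 0 ≢ 0ℤ →
  Dependent d (map (eliminate p) (pre ++ post)) → Dependent (suc d) (pre ++ p ∷ post)
dependent-pivot pre p post p0≢0 (c , |c| , c≢0 , vanish)
  with split c (length pre) (length post)
              (trans |c| (trans (List.length-map (eliminate p) (pre ++ post)) (List.length-++ pre)))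
... | c₁ , c₂ , refl , |c₁| , |c₂| = cs , |cs| , cs≢0 , vanish′
  where
  a = p 0
  K = listComb (c₁ ++ c₂) (pre ++ post) 0
  cs = map (a *_) c₁ ++ (- K) ∷ map (a *_) c₂
  |cs| : length cs ≡ length (pre ++ p ∷ post)
  |cs| = begin
      length cs
    ≡⟨ List.length-++ (map (a *_) c₁) ⟩
      length (map (a *_) c₁) ℕ.+ suc (length (map (a *_) c₂))
    ≡⟨ cong₂ (λ u w → u ℕ.+ suc w) (trans (List.length-map _ c₁) |c₁|)
                                   (trans (List.length-map _ c₂) |c₂|) ⟩
      length pre ℕ.+ suc (length post)
    ≡⟨ sym (List.length-++ pre) ⟩
      length (pre ++ p ∷ post) ∎
  scaled≢0 : ∀ xs → Nontrivial xs → Nontrivial (map (a *_) xs)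
  scaled≢0 xs = Any.map⁺ ∘ Any.map (*-≢0 p0≢0)
  cs≢0 : Nontrivial cs
  cs≢0 with Any.++⁻ c₁ c≢0
  ... | inj₁ c₁≢0 = Any.++⁺ˡ (scaled≢0 c₁ c₁≢0)
  ... | inj₂ c₂≢0 = Any.++⁺ʳ (map (a *_) c₁) (there (scaled≢0 c₂ c₂≢0))
  expand : ∀ k →
    listComb cs (pre ++ p ∷ post) k ≡ a * listComb (c₁ ++ c₂) (pre ++ post) k + - K * p k
  expand = listComb-insert a (- K) c₁ c₂ pre p post |c₁|
  cancel : ∀ a K → a * K + - K * a ≡ 0ℤ
  cancel = solve-∀
  minus : ∀ a L K q → a * L + - K * q ≡ a * L - K * q
  minus = solve-∀
  vanish′ : ∀ k → k < suc _ → listComb cs (pre ++ p ∷ post) k ≡ 0ℤ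
  vanish′ zero    _         = trans (expand 0) (cancel a K)
  vanish′ (suc k) (s≤s k<d) = begin
      listComb cs (pre ++ p ∷ post) (suc k)
    ≡⟨ expand (suc k) ⟩
      a * listComb (c₁ ++ c₂) (pre ++ post) (suc k) + - K * p (suc k)
    ≡⟨ minus a _ K (p (suc k)) ⟩
      a * listComb (c₁ ++ c₂) (pre ++ post) (suc k) - K * p (suc k)
    ≡⟨ sym (listComb-eliminate p (c₁ ++ c₂) (pre ++ post) k) ⟩
      listComb (c₁ ++ c₂) (map (eliminate p) (pre ++ post)) k
    ≡⟨ vanish k k<d ⟩
      0ℤ ∎

dependent : ∀ d (vs : List Seq) → d < length vs → Dependent d vs
dependent zero    (v ∷ vs) _ = dependent-base v vs
dependent (suc d) vs d<|vs| with All.all? (λ v → v 0 ℤ.≟ 0ℤ) vs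
... | yes vs0≡0 = dependent-shift vs vs0≡0 (dependent d (map tailSeq vs) d<|vs′|)
  where
  d<|vs′| = subst (d <_) (sym (List.length-map tailSeq vs)) (ℕ.<-trans (ℕ.n<1+n d) d<|vs|)
... | no ¬vs0≡0 with find (All.¬All⇒Any¬ (λ v → v 0 ℤ.≟ 0ℤ) vs ¬vs0≡0)
...   | p , p∈vs , p0≢0 with ∈-∃++ p∈vs
...     | pre , post , refl =
  dependent-pivot pre p post p0≢0 (dependent d (map (eliminate p) (pre ++ post)) d<|vs′|)
  where
  d<|vs′| = subst (d <_) (sym (List.length-map (eliminate p) (pre ++ post)))
                  (ℕ.≤-pred (subst (suc d <_) (length-insert pre p post) d<|vs|))

coeff-applyUpTo : ∀ (g : Seq) {k n} → n < k → coeff (applyUpTo g k) n ≡ g n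
coeff-applyUpTo g {suc k} {zero}  _         = refl
coeff-applyUpTo g {suc k} {suc n} (s≤s n<k) = coeff-applyUpTo (g ∘ suc) n<k

recurrence⇒IsRational : ∀ Q k (s : Seq) → Nontrivial Q →
  (∀ n → conv Q s (n ℕ.+ k) ≡ 0ℤ) → IsRational s
recurrence⇒IsRational (q ∷ qs) k s Q≢0 vanish with q ℤ.≟ 0ℤ
... | no q≢0 = q , qs , applyUpTo (conv (q ∷ qs) s) k , q≢0 , initial
  where
  initial : ∀ n → conv (q ∷ qs) s n ≡ coeff (applyUpTo (conv (q ∷ qs) s) k) n
  initial n with n ℕ.<? k
  ... | yes n<k = sym (coeff-applyUpTo _ n<k)
  ... | no  n≮k = begin
      conv (q ∷ qs) s n
    ≡⟨ cong (conv (q ∷ qs) s) (sym (ℕ.m∸n+n≡m (ℕ.≮⇒≥ n≮k))) ⟩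
      conv (q ∷ qs) s (n ∸ k ℕ.+ k)
    ≡⟨ vanish (n ∸ k) ⟩
      0ℤ
    ≡⟨ sym (coeff-beyond (applyUpTo (conv (q ∷ qs) s) k)
                         (ℕ.≤-trans (ℕ.≤-reflexive (List.length-applyUpTo (conv (q ∷ qs) s) k))
                                    (ℕ.≮⇒≥ n≮k))) ⟩
      coeff (applyUpTo (conv (q ∷ qs) s) k) n ∎
... | yes refl with Q≢0
...   | here 0≢0    = ⊥-elim (0≢0 refl)
...   | there qs≢0 =
  recurrence⇒IsRational qs k s qs≢0
    (λ n → trans (sym (ℤ.+-identityˡ (conv qs s (n ℕ.+ k)))) (vanish (suc n)))

count≡∑δ : ∀ c {n} (v : Vec ℕ n) → + Vec.count (ℕ._≟ c) v ≡ ∑[ y ∈ Vec.toList v ] δ c y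
count≡∑δ c Vec.[]       = refl
count≡∑δ c (y Vec.∷ v) with y ℕ.≡ᵇ c in y≡ᵇc
... | true  with ℕ.≡ᵇ⇒≡ y c (subst T (sym y≡ᵇc) tt)
...   | refl =
  trans (cong (_+_ 1ℤ) (count≡∑δ c v)) (cong (λ u → u + ∑ (Vec.toList v) (δ c)) (sym (δ-diag c)))
count≡∑δ c (y Vec.∷ v) | false =
  trans (count≡∑δ c v)
        (trans (sym (ℤ.+-identityˡ _)) (cong (λ u → u + ∑ (Vec.toList v) (δ c)) (sym (δ-off c≢y))))
  where
  c≢y : c ≢ y
  c≢y c≡y = subst T y≡ᵇc (ℕ.≡⇒≡ᵇ y c (sym c≡y))

hasForm-split : (E : ECO) (as : List ℕ) → HasForm E as →
  ∀ k → Occurs E k → prods E k ≡ cpart E (length as) k ++ map (k ℕ.+_) as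
hasForm-split E as hasForm k k-occ =
  trans (sym (List.take++drop≡id (k ∸ length as) (prods E k)))
        (cong (cpart E (length as) k ++_) (proj₂ (hasForm k k-occ)))

module Levels (E : ECO) where

  childSum : Seq → Seq
  childSum g j = ∑ (prods E j) g

  levelSum : ℕ → Seq → ℤ
  levelSum n g = ∑ (level E n) g

  levelSum-suc : ∀ n g → levelSum (suc n) g ≡ levelSum n (childSum g)
  levelSum-suc n g = ∑-concatMap g (prods E) (level E n)

  levelSum-one : ∀ n → levelSum n (λ _ → 1ℤ) ≡ ℕseries (f E) n
  levelSum-one n = ∑-one (level E n)

  levelSum-cong : ∀ n {g h : Seq} → (∀ j → Occurs E j → g j ≡ h j) → levelSum n g ≡ levelSum n h
  levelSum-cong n g≡h = ∑-cong (level E n) (λ x x∈ → g≡h x (n , x∈))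

  πℤ : ℕ → Seq
  πℤ c = ℕseries (πseries E c)

  πℤ-as-∑ : ∀ c j → πℤ c j ≡ ∑[ y ∈ prods E j ] δ c y
  πℤ-as-∑ c zero with ECO.rule E 0
  ... | Vec.[] = refl
  πℤ-as-∑ c (suc j) = count≡∑δ c (ECO.rule E (suc j))

module Rationality (E : ECO) (as : List ℕ) (C : ℕ)
  (children : ∀ k → Occurs E k → prods E k ≡ cpart E (length as) k ++ map (k ℕ.+_) as)
  (cpart≤C : ∀ k → Occurs E k → All (_≤ C) (cpart E (length as) k))
  (rational : ∀ k → k ≤ C → IsRational (ℕseries (πseries E k))) where

  open Levels E

  smallLabels : List ℕ
  smallLabels = downFrom (suc C)

  lowPart : Seq → Seq
  lowPart g y = ∑[ z ∈ smallLabels ] g z * δ z y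

  childSum-split : ∀ h j → Occurs E j →
    childSum h j ≡ ∑ (cpart E (length as) j) h + (∑[ a ∈ as ] h (j ℕ.+ a))
  childSum-split h j j-occ = begin
      ∑ (prods E j) h
    ≡⟨ cong (λ ys → ∑ ys h) (children j j-occ) ⟩
      ∑ (cp ++ map (j ℕ.+_) as) h
    ≡⟨ ∑-++ h cp (map (j ℕ.+_) as) ⟩
      ∑ cp h + ∑ (map (j ℕ.+_) as) h
    ≡⟨ cong (_+_ (∑ cp h)) (∑-map h (j ℕ.+_) as) ⟩
      ∑ cp h + (∑[ a ∈ as ] h (j ℕ.+ a)) ∎
    where
    cp = cpart E (length as) j

  ∑-πℤ : ∀ g j → (∑[ c ∈ smallLabels ] g c * πℤ c j) ≡ childSum (lowPart g) j
  ∑-πℤ g j = begin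
      (∑[ c ∈ smallLabels ] g c * πℤ c j)
    ≡⟨ ∑-ext smallLabels (λ c → trans (cong (g c *_) (πℤ-as-∑ c j))
                                      (sym (∑-scale (g c) (δ c) (prods E j)))) ⟩
      (∑[ c ∈ smallLabels ] ∑[ y ∈ prods E j ] g c * δ c y)
    ≡⟨ ∑-comm (λ c y → g c * δ c y) smallLabels (prods E j) ⟩
      childSum (lowPart g) j ∎

  childSum-decomposition : ∀ g j → Occurs E j →
    childSum g j ≡
    (∑[ c ∈ smallLabels ] g c * πℤ c j) + (∑[ a ∈ as ] (g (j ℕ.+ a) - lowPart g (j ℕ.+ a)))
  childSum-decomposition g j j-occ = sym (begin
      (∑[ c ∈ smallLabels ] g c * πℤ c j) + (∑[ a ∈ as ] (g (j ℕ.+ a) - lowPart g (j ℕ.+ a)))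
    ≡⟨ cong₂ _+_ (trans (∑-πℤ g j) (childSum-split (lowPart g) j j-occ))
                 (∑-sub (λ a → g (j ℕ.+ a)) (λ a → lowPart g (j ℕ.+ a)) as) ⟩
      ∑ cp (lowPart g) + L + (G - L)
    ≡⟨ cong (λ x → x + L + (G - L)) (∑-cong cp lowPart-cp) ⟩
      ∑ cp g + L + (G - L)
    ≡⟨ cancel (∑ cp g) L G ⟩
      ∑ cp g + G
    ≡⟨ sym (childSum-split g j j-occ) ⟩
      childSum g j ∎)
    where
    cp = cpart E (length as) j
    L = ∑[ a ∈ as ] lowPart g (j ℕ.+ a)
    G = ∑[ a ∈ as ] g (j ℕ.+ a)
    lowPart-cp : ∀ y → y ∈ cp → lowPart g y ≡ g y
    lowPart-cp y y∈cp = ∑-δ-downFrom g (s≤s (All.lookup (cpart≤C j j-occ) y∈cp))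
    cancel : ∀ X L G → X + L + (G - L) ≡ X + G
    cancel = solve-∀

  ρ : (i : Fin (suc C)) → RationalForm (πℤ (toℕ i))
  ρ i = toRationalForm (rational (toℕ i) (ℕ.≤-pred (Fin.toℕ<n i)))

  shift : Seq → ℕ → Seq
  shift s r j = s (j ℕ.+ r)

  block : Fin (suc C) → List Seq
  block i = map δ (downFrom (length numer)) ++ map (shift (πℤ (toℕ i))) (downFrom (suc (length qs)))
    where open RationalForm (ρ i)

  generators : List Seq
  generators = (λ _ → 1ℤ) ∷ map δ smallLabels ++ concatMap block (allFin (suc C))

  open Span generators (Occurs E)

  InSpan-δ : ∀ y → y < suc C → InSpan (δ y)
  InSpan-δ y y<1+C = InSpan-gen (there (∈-++⁺ˡ (∈-map⁺ δ (∈-downFrom⁺ y<1+C))))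

  block⊆generators : ∀ i {g} → g ∈ block i → g ∈ generators
  block⊆generators i g∈ =
    there (∈-++⁺ʳ (map δ smallLabels) (∈-concatMap⁺ block (lose (∈-allFin i) g∈)))

  module _ (i : Fin (suc C)) where

    open RationalForm (ρ i)

    InSpan-numerator : ∀ y → y < length numer → InSpan (δ y)
    InSpan-numerator y y< = InSpan-gen (block⊆generators i (∈-++⁺ˡ (∈-map⁺ δ (∈-downFrom⁺ y<))))

    InSpan-πℤ-shift : ∀ r → r ≤ length qs → InSpan (shift (πℤ (toℕ i)) r)
    InSpan-πℤ-shift r r≤ = InSpan-gen (block⊆generators i
      (∈-++⁺ʳ (map δ (downFrom (length numer)))
              (∈-map⁺ (shift (πℤ (toℕ i))) (∈-downFrom⁺ (s≤s r≤)))))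

    InSpan-πℤ-scaledShift : ∀ t → InSpan (λ j → q₀ ^ t * πℤ (toℕ i) (j ℕ.+ t))
    InSpan-πℤ-scaledShift = InSpan-rationalShift (ρ i) InSpan-πℤ-shift InSpan-numerator

  InSpan-πℤ : ∀ c → c < suc C → InSpan (πℤ c)
  InSpan-πℤ c c<1+C = subst (InSpan ∘ πℤ) (Fin.toℕ-fromℕ< c<1+C)
    (InSpan-resp (λ j → cong (πℤ _) (ℕ.+-identityʳ j)) (InSpan-πℤ-shift (fromℕ< c<1+C) 0 z≤n))

  Clears : ℤ → Seq → Set
  Clears μ g = All (λ a → InSpan (λ j → μ * g (j ℕ.+ a))) as

  Clears-scale : ∀ {μ : ℤ} {g : Seq} (ν : ℤ) → Clears μ g → Clears (ν * μ) g
  Clears-scale ν = All.map (InSpan-rescale ν)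

  ClearedBySome : Seq → Set
  ClearedBySome g = ∃ λ μ → μ ≢ 0ℤ × Clears μ g

  clears-δ : ∀ {N} → (∀ y → y < N → InSpan (δ y)) → ∀ y → y < N → ClearedBySome (δ y)
  clears-δ δ∈ y y<N =
    1ℤ , (λ ()) , All.tabulate (λ {a} _ → InSpan-scale 1ℤ (InSpan-δ-shift δ∈ a y<N))

  clears-πℤ-shift : ∀ i r → ClearedBySome (shift (πℤ (toℕ i)) r)
  clears-πℤ-shift i r =
    common-multiple (λ μ a → InSpan (λ j → μ * shift (πℤ (toℕ i)) r (j ℕ.+ a))) InSpan-rescale
                    (All.tabulate (λ {a} _ → scaled a))
    where
    open RationalForm (ρ i)
    scaled : ∀ a → ∃ λ μ → μ ≢ 0ℤ × InSpan (λ j → μ * shift (πℤ (toℕ i)) r (j ℕ.+ a))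
    scaled a = q₀ ^ (a ℕ.+ r) , ^-≢0 (a ℕ.+ r) q₀≢0 ,
      InSpan-resp (λ j → cong (λ m → q₀ ^ (a ℕ.+ r) * πℤ (toℕ i) m) (sym (ℕ.+-assoc j a r)))
                  (InSpan-πℤ-scaledShift i (a ℕ.+ r))

  generators-cleared : All ClearedBySome generators
  generators-cleared =
    (1ℤ , (λ ()) , All.tabulate (λ _ → InSpan-scale 1ℤ (InSpan-gen (here refl)))) All.∷
    All.++⁺ (All.map⁺ (All.tabulate (λ y∈ → clears-δ InSpan-δ _ (∈-downFrom⁻ y∈))))
            (All.concat⁺ (All.map⁺ (All.tabulate⁺ block-cleared)))
    where
    block-cleared : ∀ i → All ClearedBySome (block i)
    block-cleared i =
      All.++⁺ (All.map⁺ (All.tabulate (λ y∈ → clears-δ (InSpan-numerator i) _ (∈-downFrom⁻ y∈))))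
              (All.map⁺ (All.tabulate (λ _ → clears-πℤ-shift i _)))

  -- Kept opaque: unfolding μ in conversion checks is prohibitively expensive.
  opaque
    cleared : ∃ λ μ → μ ≢ 0ℤ × All (Clears μ) generators
    cleared = common-multiple Clears (λ {μ} {g} ν → Clears-scale {μ} {g} ν) generators-cleared

  μ : ℤ
  μ = proj₁ cleared

  μ≢0 : μ ≢ 0ℤ
  μ≢0 = proj₁ (proj₂ cleared)

  μchildSum : Seq → Seq
  μchildSum g j = μ * childSum g j

  InSpan-lowPart-shift : ∀ g a → InSpan (λ j → lowPart g (j ℕ.+ a))
  InSpan-lowPart-shift g a =
    InSpan-∑ smallLabels _
      (λ z z∈ → InSpan-scale (g z) (InSpan-δ-shift InSpan-δ a (∈-downFrom⁻ z∈)))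

  InSpan-μchildSum : ∀ {g} → Clears μ g → InSpan (μchildSum g)
  InSpan-μchildSum {g} μg∈ = InSpan-resp-on eq (InSpan-+ (InSpan-scale μ small) (InSpan-∑ as _ shifted))
    where
    small : InSpan (λ j → ∑[ c ∈ smallLabels ] g c * πℤ c j)
    small = InSpan-∑ smallLabels _ (λ c c∈ → InSpan-scale (g c) (InSpan-πℤ c (∈-downFrom⁻ c∈)))
    shifted : ∀ a → a ∈ as → InSpan (λ j → μ * g (j ℕ.+ a) - μ * lowPart g (j ℕ.+ a))
    shifted a a∈ = InSpan-sub (All.lookup μg∈ a∈) (InSpan-scale μ (InSpan-lowPart-shift g a))
    distrib : ∀ m u v → m * (u - v) ≡ m * u - m * v
    distrib = solve-∀
    eq : ∀ j → Occurs E j →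
      μ * (∑[ c ∈ smallLabels ] g c * πℤ c j) +
      (∑[ a ∈ as ] (μ * g (j ℕ.+ a) - μ * lowPart g (j ℕ.+ a))) ≡
      μchildSum g j
    eq j j-occ = sym (begin
        μ * childSum g j
      ≡⟨ cong (μ *_) (childSum-decomposition g j j-occ) ⟩
        μ * (X + (∑[ a ∈ as ] (g (j ℕ.+ a) - lowPart g (j ℕ.+ a))))
      ≡⟨ ℤ.*-distribˡ-+ μ X _ ⟩
        μ * X + μ * (∑[ a ∈ as ] (g (j ℕ.+ a) - lowPart g (j ℕ.+ a)))
      ≡⟨ cong (_+_ (μ * X)) (sym (∑-scale μ _ as)) ⟩
        μ * X + (∑[ a ∈ as ] μ * (g (j ℕ.+ a) - lowPart g (j ℕ.+ a)))
      ≡⟨ cong (_+_ (μ * X)) (∑-ext as (λ a → distrib μ (g (j ℕ.+ a)) (lowPart g (j ℕ.+ a)))) ⟩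
        μ * X + (∑[ a ∈ as ] (μ * g (j ℕ.+ a) - μ * lowPart g (j ℕ.+ a))) ∎)
      where
      X = ∑[ c ∈ smallLabels ] g c * πℤ c j

  InSpan-μchildSum-comb : ∀ α → InSpan (μchildSum (comb α generators))
  InSpan-μchildSum-comb =
    InSpan-image μchildSum linear L-zero (All.map InSpan-μchildSum (proj₂ (proj₂ cleared)))
    where
    regroup : ∀ m a u v → m * (a * u + v) ≡ a * (m * u) + m * v
    regroup = solve-∀
    linear : ∀ a g h x → μchildSum (λ y → a * g y + h y) x ≡ a * μchildSum g x + μchildSum h x
    linear a g h x =
      trans (cong (μ *_) (∑-linear a g h (prods E x))) (regroup μ a (childSum g x) (childSum h x))
    L-zero : ∀ x → μchildSum (λ _ → 0ℤ) x ≡ 0ℤ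
    L-zero x = trans (cong (μ *_) (∑-zero (prods E x))) (ℤ.*-zeroʳ μ)

  F : Seq
  F = ℕseries (f E)

  w : ℕ → Seq
  w zero    = proj₁ (InSpan-gen (here refl))
  w (suc k) = proj₁ (InSpan-μchildSum-comb (w k))

  levelSum-w : ∀ k n → levelSum n (comb (w k) generators) ≡ μ ^ k * F (n ℕ.+ k)
  levelSum-w zero n = begin
      levelSum n (comb (w 0) generators)
    ≡⟨ levelSum-cong n (λ j j-occ → sym (proj₂ (InSpan-gen (here refl)) j j-occ)) ⟩
      levelSum n (λ _ → 1ℤ)
    ≡⟨ levelSum-one n ⟩
      F n
    ≡⟨ sym (trans (ℤ.*-identityˡ (F (n ℕ.+ 0))) (cong F (ℕ.+-identityʳ n))) ⟩
      1ℤ * F (n ℕ.+ 0) ∎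
  levelSum-w (suc k) n = begin
      levelSum n (comb (w (suc k)) generators)
    ≡⟨ levelSum-cong n (λ j j-occ → sym (proj₂ (InSpan-μchildSum-comb (w k)) j j-occ)) ⟩
      levelSum n (μchildSum (comb (w k) generators))
    ≡⟨ ∑-scale μ _ (level E n) ⟩
      μ * levelSum n (childSum (comb (w k) generators))
    ≡⟨ cong (μ *_) (sym (levelSum-suc n _)) ⟩
      μ * levelSum (suc n) (comb (w k) generators)
    ≡⟨ cong (μ *_) (levelSum-w k (suc n)) ⟩
      μ * (μ ^ k * F (suc (n ℕ.+ k)))
    ≡⟨ sym (ℤ.*-assoc μ (μ ^ k) _) ⟩
      μ ^ suc k * F (suc (n ℕ.+ k))
    ≡⟨ cong (λ m → μ ^ suc k * F m) (sym (ℕ.+-suc n k)) ⟩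
      μ ^ suc k * F (n ℕ.+ suc k) ∎

  weights : List ℤ → ℕ → List ℤ
  weights []       k = []
  weights (c ∷ cs) k = c * μ ^ k ∷ weights cs (k ∸ 1)

  weights-nontrivial : ∀ cs k → Nontrivial cs → Nontrivial (weights cs k)
  weights-nontrivial (c ∷ cs) k (here c≢0)   = here (*-≢0 c≢0 (^-≢0 k μ≢0))
  weights-nontrivial (c ∷ cs) k (there cs≢0) = there (weights-nontrivial cs (k ∸ 1) cs≢0)

  levelSum-comb-cons : ∀ n c cs v vs →
    levelSum n (comb (listComb (c ∷ cs) (v ∷ vs)) generators) ≡
    c * levelSum n (comb v generators) + levelSum n (comb (listComb cs vs) generators)
  levelSum-comb-cons n c cs v vs =
    trans (∑-ext (level E n) (comb-linear c v (listComb cs vs) generators)) (∑-linear c _ _ (level E n))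

  levelSum-comb-zero : ∀ n → levelSum n (comb (λ _ → 0ℤ) generators) ≡ 0ℤ
  levelSum-comb-zero n =
    trans (∑-ext (level E n) (comb-vanishing _ generators (λ _ _ → refl))) (∑-zero (level E n))

  levelSum-relation : ∀ k cs → length cs ≡ suc k → ∀ n →
    levelSum n (comb (listComb cs (applyDownFrom w (suc k))) generators) ≡ conv (weights cs k) F (n ℕ.+ k)
  levelSum-relation zero (c ∷ []) _ n = begin
      levelSum n (comb (listComb (c ∷ []) (w 0 ∷ [])) generators)
    ≡⟨ levelSum-comb-cons n c [] (w 0) [] ⟩
      c * levelSum n (comb (w 0) generators) + levelSum n (comb (λ _ → 0ℤ) generators)
    ≡⟨ cong₂ (λ u v → c * u + v) (levelSum-w 0 n) (levelSum-comb-zero n) ⟩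
      c * (μ ^ 0 * F (n ℕ.+ 0)) + 0ℤ
    ≡⟨ regroup c (μ ^ 0) (F (n ℕ.+ 0)) ⟩
      c * μ ^ 0 * F (n ℕ.+ 0)
    ≡⟨ sym (conv-singleton (c * μ ^ 0) F (n ℕ.+ 0)) ⟩
      conv (weights (c ∷ []) 0) F (n ℕ.+ 0) ∎
    where
    regroup : ∀ c m x → c * (m * x) + 0ℤ ≡ c * m * x
    regroup = solve-∀
  levelSum-relation (suc k) (c ∷ cs) |cs| n = begin
      levelSum n (comb (listComb (c ∷ cs) (w (suc k) ∷ applyDownFrom w (suc k))) generators)
    ≡⟨ levelSum-comb-cons n c cs (w (suc k)) (applyDownFrom w (suc k)) ⟩
      c * levelSum n (comb (w (suc k)) generators) +
      levelSum n (comb (listComb cs (applyDownFrom w (suc k))) generators)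
    ≡⟨ cong₂ (λ u v → c * u + v) (levelSum-w (suc k) n)
                                 (levelSum-relation k cs (ℕ.suc-injective |cs|) n) ⟩
      c * (μ ^ suc k * F (n ℕ.+ suc k)) + conv (weights cs k) F (n ℕ.+ k)
    ≡⟨ cong (λ m → c * (μ ^ suc k * F m) + conv (weights cs k) F (n ℕ.+ k)) (ℕ.+-suc n k) ⟩
      c * (μ ^ suc k * F (suc (n ℕ.+ k))) + conv (weights cs k) F (n ℕ.+ k)
    ≡⟨ cong (λ u → u + conv (weights cs k) F (n ℕ.+ k)) (sym (ℤ.*-assoc c (μ ^ suc k) _)) ⟩
      conv (weights (c ∷ cs) (suc k)) F (suc (n ℕ.+ k))
    ≡⟨ cong (conv (weights (c ∷ cs) (suc k)) F) (sym (ℕ.+-suc n k)) ⟩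
      conv (weights (c ∷ cs) (suc k)) F (n ℕ.+ suc k) ∎

  d : ℕ
  d = length generators

  IsRational-fromDependency : Dependent d (applyDownFrom w (suc d)) → IsRational F
  IsRational-fromDependency (cs , |cs| , cs≢0 , vanish) =
    recurrence⇒IsRational (weights cs d) d F (weights-nontrivial cs d cs≢0) relation
    where
    relation : ∀ n → conv (weights cs d) F (n ℕ.+ d) ≡ 0ℤ
    relation n = begin
        conv (weights cs d) F (n ℕ.+ d)
      ≡⟨ sym (levelSum-relation d cs (trans |cs| (List.length-applyDownFrom w (suc d))) n) ⟩
        levelSum n (comb (listComb cs (applyDownFrom w (suc d))) generators)
      ≡⟨ ∑-ext (level E n) (comb-vanishing _ generators vanish) ⟩
        levelSum n (λ _ → 0ℤ)
      ≡⟨ ∑-zero (level E n) ⟩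
        0ℤ ∎

proposition4 : (E : ECO) (as : List ℕ) →
    All (1 ≤_) as → Linked _≤_ as →
    HasForm E as →
    (∃ λ B → ∀ k → Occurs E k → All (_≤ B) (cpart E (Data.List.length as) k)) →
    (C : ℕ) → IsMaxC E as C →
    (∀ k → k ≤ C → IsRational (ℕseries (πseries E k))) →
    IsRational (ℕseries (f E))
proposition4 E as _ _ hasForm _ C (_ , cpart≤C , _) rational =
  IsRational-fromDependency (dependent d (applyDownFrom w (suc d)) d<|ws|)
  where
  open Rationality E as C (hasForm-split E as hasForm) cpart≤C rational
  d<|ws| : d < length (applyDownFrom w (suc d))
  d<|ws| = subst (d <_) (sym (List.length-applyDownFrom w (suc d))) (ℕ.n<1+n d)
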